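{- Let $\mathcal V$ be a univalent universe and assume small set quotients exist. Then for every type $I:\mathcal V$ and every family $\alpha:I\to\mathrm{Ord}_{\mathcal V}$ of ordinals, $\alpha$ has a least upper bound in $\mathrm{Ord}_{\mathcal V}$ with respect to $\preceq$.
   Context: Setting: intensional Martin-Löf type theory with non-cumulative universes, function extensionality, propositional extensionality, propositional truncations ($\exists$ denotes the truncated $\Sigma$). An ordinal in $\mathcal V$ is a type $\alpha:\mathcal V$ with a relation $\prec:\alpha\to\alpha\to\mathcal V$ that is proposition-valued, transitive, extensional (if $z\prec x\leftrightarrow z\prec y$ for all $z$ then $x=y$) and well-founded (every element is accessible). $\mathrm{Ord}_{\mathcal V}$ is the type of ordinals in $\mathcal V$ (a type in $\mathcal V^+$). For $x:\alpha$, $\alpha\downarrow x$ is the ordinal of elements $b:\alpha$ with $b\prec x$, with the restricted order. For $\alpha,\beta:\mathrm{Ord}_{\mathcal V}$, $\alpha\prec\beta$ iff there exists $y:\beta$ such that $\alpha$ and $\beta\downarrow y$ are isomorphic ordinals; $\alpha\preceq\beta$ iff for every $\gamma:\mathrm{Ord}_{\mathcal V}$, $\gamma\prec\alpha$ implies $\gamma\prec\beta$ (equivalently, there is a simulation $\alpha\to\beta$). Small set quotients exist: for every type $X:\mathcal U$ and $\mathcal W$-valued proposition-valued equivalence relation $\approx$ on $X$ there is a set $X/{\approx}$ in $\mathcal U\sqcup\mathcal W$ with a map $\eta:X\to X/{\approx}$ respecting $\approx$ such that every map from $X$ to a set in any universe respecting $\approx$ factors uniquely through $\eta$. -}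

{-# OPTIONS --without-K #-}
module Defs where

open import Level using (Level; _⊔_; Setω) renaming (suc to lsuc)
open import Data.Product using (Σ; Σ-syntax; _×_; _,_; proj₁; proj₂)
open import Relation.Binary.PropositionalEquality using (_≡_; refl)
open import Induction.WellFounded using (Acc; WellFounded)

isContr : ∀ {a} → Set a → Set a
isContr A = Σ[ c ∈ A ] ((x : A) → c ≡ x)

isProp : ∀ {a} → Set a → Set a
isProp A = (x y : A) → x ≡ y

isSet : ∀ {a} → Set a → Set a
isSet A = (x y : A) → isProp (x ≡ y)

fiber : ∀ {a b} {A : Set a} {B : Set b} → (A → B) → B → Set (a ⊔ b)
fiber {A = A} f y = Σ[ x ∈ A ] (f x ≡ y)

isEquiv : ∀ {a b} {A : Set a} {B : Set b} → (A → B) → Set (a ⊔ b)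
isEquiv {B = B} f = (y : B) → isContr (fiber f y)

_≃_ : ∀ {a b} → Set a → Set b → Set (a ⊔ b)
A ≃ B = Σ[ f ∈ (A → B) ] isEquiv f

_↔_ : ∀ {a b} → Set a → Set b → Set (a ⊔ b)
A ↔ B = (A → B) × (B → A)

idtoeqv : ∀ {a} {X Y : Set a} → X ≡ Y → X ≃ Y
idtoeqv refl = (λ x → x) , λ y → (y , refl) , λ { (x , refl) → refl }

Univalence : (ℓ : Level) → Set (lsuc ℓ)
Univalence ℓ = (X Y : Set ℓ) → isEquiv (idtoeqv {ℓ} {X} {Y})

FunExt : Setω
FunExt = ∀ {a b} {A : Set a} {B : A → Set b} {f g : (x : A) → B x}
       → ((x : A) → f x ≡ g x) → f ≡ g

PropExt : Setω
PropExt = ∀ {a} {P Q : Set a} → isProp P → isProp Q → (P → Q) → (Q → P) → P ≡ Q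

record PropTrunc : Setω where
  field
    ∥_∥         : ∀ {a} → Set a → Set a
    ∥∥-isProp   : ∀ {a} {A : Set a} → isProp ∥ A ∥
    ∣_∣         : ∀ {a} {A : Set a} → A → ∥ A ∥
    ∥∥-rec      : ∀ {a b} {A : Set a} {P : Set b} → isProp P → (A → P) → ∥ A ∥ → P

  ∃̇ : ∀ {a b} (A : Set a) → (A → Set b) → Set (a ⊔ b)
  ∃̇ A B = ∥ Σ A B ∥

record IsPropEquivRel {u w} {X : Set u} (_≈_ : X → X → Set w) : Set (u ⊔ w) where
  field
    ≈-isProp : (x y : X) → isProp (x ≈ y)
    ≈-refl   : (x : X) → x ≈ x
    ≈-sym    : (x y : X) → x ≈ y → y ≈ x
    ≈-trans  : (x y z : X) → x ≈ y → y ≈ z → x ≈ z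

-- A set quotient of X by ≈, living in Set (u ⊔ w) (small set quotient),
-- with the universal property with respect to sets in any universe.
record SetQuotient {u w} (X : Set u) (_≈_ : X → X → Set w) : Setω where
  field
    Q          : Set (u ⊔ w)
    Q-isSet    : isSet Q
    η          : X → Q
    η-respects : (x y : X) → x ≈ y → η x ≡ η y
    universal  : ∀ {t} (B : Set t) → isSet B → (f : X → B)
               → ((x y : X) → x ≈ y → f x ≡ f y)
               → isContr (Σ[ g ∈ (Q → B) ] ((x : X) → g (η x) ≡ f x))

SmallSetQuotients : Setω
SmallSetQuotients = ∀ {u w} (X : Set u) (_≈_ : X → X → Set w)
                  → IsPropEquivRel _≈_ → SetQuotient X _≈_

record IsOrdinal {ℓ} (A : Set ℓ) (_≺_ : A → A → Set ℓ) : Set ℓ where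
  field
    prop-valued  : (x y : A) → isProp (x ≺ y)
    transitive   : (x y z : A) → x ≺ y → y ≺ z → x ≺ z
    extensional  : (x y : A) → ((z : A) → (z ≺ x) ↔ (z ≺ y)) → x ≡ y
    well-founded : (x : A) → Acc _≺_ x

record Ordinal (ℓ : Level) : Set (lsuc ℓ) where
  field
    ⟨_⟩       : Set ℓ
    _≺_       : ⟨_⟩ → ⟨_⟩ → Set ℓ
    isOrdinal : IsOrdinal ⟨_⟩ _≺_

open Ordinal public

module OrdinalOrder (pt : PropTrunc) where
  open PropTrunc pt

  _≅_ : ∀ {ℓ} {A B : Set ℓ} → (A → A → Set ℓ) → (B → B → Set ℓ) → Set ℓ
  _≅_ {A = A} {B = B} _<₁_ _<₂_ =
    Σ[ f ∈ (A → B) ] (isEquiv f × ((x y : A) → (x <₁ y) ↔ (f x <₂ f y)))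

  ↓-carrier : ∀ {ℓ} (α : Ordinal ℓ) → ⟨ α ⟩ → Set ℓ
  ↓-carrier α x = Σ[ b ∈ ⟨ α ⟩ ] (_≺_ α b x)

  ↓-order : ∀ {ℓ} (α : Ordinal ℓ) (x : ⟨ α ⟩) → ↓-carrier α x → ↓-carrier α x → Set ℓ
  ↓-order α x (b , _) (c , _) = _≺_ α b c

  _≺ₒ_ : ∀ {ℓ} → Ordinal ℓ → Ordinal ℓ → Set ℓ
  α ≺ₒ β = ∃̇ ⟨ β ⟩ (λ y → _≅_ (_≺_ α) (↓-order β y))

  _⪯_ : ∀ {ℓ} → Ordinal ℓ → Ordinal ℓ → Set (lsuc ℓ)
  _⪯_ {ℓ} α β = (γ : Ordinal ℓ) → γ ≺ₒ α → γ ≺ₒ β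

  IsLUB : ∀ {ℓ} {I : Set ℓ} → (I → Ordinal ℓ) → Ordinal ℓ → Set (lsuc ℓ)
  IsLUB {ℓ} {I} α s = ((i : I) → α i ⪯ s)
                    × ((t : Ordinal ℓ) → ((i : I) → α i ⪯ t) → s ⪯ t)

  HasLUB : ∀ {ℓ} {I : Set ℓ} → (I → Ordinal ℓ) → Set (lsuc ℓ)
  HasLUB {ℓ} α = Σ[ s ∈ Ordinal ℓ ] IsLUB α s

{-# OPTIONS --without-K #-}
module Submission where

-- The supremum is the quotient of Σ i, α i identifying two points whose initial
-- segments are isomorphic, where [p] < [q] when the segment of p is isomorphic to
-- the segment of a point below q in q's own ordinal. The initial segment of α i
-- below x is then isomorphic to that of the quotient below [i , x]. Hence every
-- initial segment of an α i is one of the sup, and, since every element of the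
-- quotient is a class [i , x], every initial segment of the sup is one of some α i.

open import Level using (Level; _⊔_)
open import Data.Product using (Σ; Σ-syntax; _×_; _,_; proj₁; proj₂)
open import Data.Unit using (⊤; tt)
open import Relation.Binary.Core using (Rel)
open import Relation.Binary.PropositionalEquality using (_≡_; refl; sym; trans; cong; cong₂; subst; subst₂)
open import Induction.WellFounded using (Acc; acc)
open import Axiom.UniquenessOfIdentityProofs using (module Constant⇒UIP)
open import Defs

private
  variable
    a b c : Level
    A : Set a
    B : Set b
    C : Set c

Σ-≡-prop : {P : A → Set b} → (∀ x → isProp (P x))
         → {x x' : A} {u : P x} {u' : P x'} → x ≡ x' → _≡_ {A = Σ A P} (x , u) (x' , u')
Σ-≡-prop P-prop {x} refl = cong (x ,_) (P-prop x _ _)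

hedberg : (R : A → A → Set b) → (∀ x y → isProp (R x y))
        → (∀ x → R x x) → (∀ x y → R x y → x ≡ y) → isSet A
hedberg R R-prop R-refl R⇒≡ _ _ = ≡-irrelevant
  where
    normalise : ∀ {x y} → x ≡ y → x ≡ y
    normalise {x} {y} p = R⇒≡ x y (subst (R x) p (R-refl x))

    normalise-constant : ∀ {x y} (p q : x ≡ y) → normalise p ≡ normalise q
    normalise-constant {x} {y} _ _ = cong (R⇒≡ x y) (R-prop x y _ _)

    open Constant⇒UIP normalise normalise-constant

isProp⇒isSet : isProp A → isSet A
isProp⇒isSet A-prop = hedberg (λ _ _ → ⊤) (λ _ _ _ _ → refl) (λ _ → tt) (λ x y _ → A-prop x y)

Σ-isSet : {P : A → Set b} → isSet A → (∀ x → isProp (P x)) → isSet (Σ A P)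
Σ-isSet A-set P-prop =
  hedberg (λ s t → proj₁ s ≡ proj₁ t) (λ _ _ → A-set _ _) (λ _ → refl) (λ _ _ → Σ-≡-prop P-prop)

module _ (fe : FunExt) where

  Π-isProp : {P : A → Set b} → (∀ x → isProp (P x)) → isProp ((x : A) → P x)
  Π-isProp P-prop f g = fe λ x → P-prop x (f x) (g x)

  ↔-isProp : isProp A → isProp B → isProp (A ↔ B)
  ↔-isProp A-prop B-prop _ _ = cong₂ _,_ (fe λ _ → B-prop _ _) (fe λ _ → A-prop _ _)

  isProp-isProp : isProp (isProp A)
  isProp-isProp p q = fe λ x → fe λ y → isProp⇒isSet p x y (p x y) (q x y)

  Acc-isProp : {R : Rel A b} {x : A} → isProp (Acc R x)
  Acc-isProp {R = R} (acc rs) (acc rs') =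
    cong (λ (k : ∀ y → R y _ → Acc R y) → acc λ {y} → k y)
         (fe λ y → fe λ y<x → Acc-isProp (rs y<x) (rs' y<x))

  hProp-isSet : PropExt → isSet (Σ (Set a) isProp)
  hProp-isSet pe = hedberg (λ P Q → proj₁ P ↔ proj₁ Q)
    (λ P Q → ↔-isProp (proj₂ P) (proj₂ Q))
    (λ _ → (λ x → x) , (λ x → x))
    (λ P Q (f , g) → Σ-≡-prop (λ _ → isProp-isProp) (pe (proj₂ P) (proj₂ Q) f g))

module _ (pt : PropTrunc) where
  open PropTrunc pt

  ∥∥-map : (A → B) → ∥ A ∥ → ∥ B ∥
  ∥∥-map f = ∥∥-rec ∥∥-isProp λ x → ∣ f x ∣

  ∥∥-map₂ : (A → B → C) → ∥ A ∥ → ∥ B ∥ → ∥ C ∥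
  ∥∥-map₂ f x y = ∥∥-rec ∥∥-isProp (λ x' → ∥∥-map (f x') y) x

  injective-surjective⇒isEquiv : (f : A → B) → isSet B → (∀ x x' → f x ≡ f x' → x ≡ x')
                               → (∀ y → ∥ fiber f y ∥) → isEquiv f
  injective-surjective⇒isEquiv f B-set f-injective f-surjective y =
    ∥∥-rec fiber-isProp (λ z → z) (f-surjective y) , fiber-isProp _
    where
      fiber-isProp : isProp (fiber f y)
      fiber-isProp (x , fx≡y) (x' , fx'≡y) = lemma (f-injective x x' (trans fx≡y (sym fx'≡y))) fx≡y fx'≡y
        where
          lemma : ∀ {x x'} → x ≡ x' → (e : f x ≡ y) (e' : f x' ≡ y) → _≡_ {A = fiber f y} (x , e) (x' , e')
          lemma {x} refl e e' = cong (x ,_) (B-set _ _ e e')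

module _ {X : Set a} {_≈_ : Rel X b} (≈-equiv : IsPropEquivRel _≈_) (quotient : SetQuotient X _≈_) where
  open IsPropEquivRel ≈-equiv
  open SetQuotient quotient

  η-effective : FunExt → PropExt → ∀ x y → η x ≡ η y → x ≈ y
  η-effective fe pe x y ηx≡ηy = subst proj₁ Fy≡Fx (≈-refl y)
    where
      F : X → Σ (Set b) isProp
      F z = (z ≈ y) , ≈-isProp z y

      F-respects : ∀ z z' → z ≈ z' → F z ≡ F z'
      F-respects z z' z≈z' = Σ-≡-prop (λ _ → isProp-isProp fe)
        (pe (≈-isProp z y) (≈-isProp z' y) (≈-trans z' z y (≈-sym z z' z≈z')) (≈-trans z z' y z≈z'))

      factorisation : Σ[ G ∈ (Q → Σ (Set b) isProp) ] (∀ z → G (η z) ≡ F z)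
      factorisation = proj₁ (universal _ (hProp-isSet fe pe) F F-respects)

      Fy≡Fx : F y ≡ F x
      Fy≡Fx = trans (sym (proj₂ factorisation y))
                    (trans (cong (proj₁ factorisation) (sym ηx≡ηy)) (proj₂ factorisation x))

  module _ (pt : PropTrunc) where
    open PropTrunc pt

    η-surjective : ∀ u → ∥ fiber η u ∥
    η-surjective u = subst (λ v → ∥ fiber η v ∥) (cong (λ h → h u) G₁≡id) (proj₂ (G u))
      where
        Image : Set (a ⊔ b)
        Image = Σ Q λ v → ∥ fiber η v ∥

        F : X → Image
        F x = η x , ∣ x , refl ∣

        factorisation : Σ[ G ∈ (Q → Image) ] (∀ x → G (η x) ≡ F x)
        factorisation = proj₁ (universal Image (Σ-isSet Q-isSet λ _ → ∥∥-isProp) F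
                                 λ x y x≈y → Σ-≡-prop (λ _ → ∥∥-isProp) (η-respects x y x≈y))

        G : Q → Image
        G = proj₁ factorisation

        η-factors-uniquely : isContr (Σ[ h ∈ (Q → Q) ] (∀ x → h (η x) ≡ η x))
        η-factors-uniquely = universal Q Q-isSet η η-respects

        factorisations-of-η-unique : ∀ h → (∀ x → h (η x) ≡ η x) → h ≡ (λ v → v)
        factorisations-of-η-unique h hη≡η =
          cong proj₁ (trans (sym (proj₂ η-factors-uniquely (h , hη≡η)))
                            (proj₂ η-factors-uniquely ((λ v → v) , λ _ → refl)))

        G₁≡id : (λ v → proj₁ (G v)) ≡ (λ v → v)
        G₁≡id = factorisations-of-η-unique _ λ x → cong proj₁ (proj₂ factorisation x)

    η-induction : (P : Q → Set c) → (∀ u → isProp (P u)) → (∀ x → P (η x)) → ∀ u → P u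
    η-induction P P-prop P-η u =
      ∥∥-rec (P-prop u) (λ (x , ηx≡u) → subst P ηx≡u (P-η x)) (η-surjective u)

record _≃ₒ_ {A B : Set a} (_<₁_ : Rel A a) (_<₂_ : Rel B a) : Set a where
  field
    to        : A → B
    from      : B → A
    from-to   : ∀ x → from (to x) ≡ x
    to-from   : ∀ y → to (from y) ≡ y
    to-pres   : ∀ {x y} → x <₁ y → to x <₂ to y
    from-pres : ∀ {x y} → x <₂ y → from x <₁ from y

open _≃ₒ_

≃ₒ-refl : {A : Set a} {R : Rel A a} → R ≃ₒ R
≃ₒ-refl = record { to = λ x → x ; from = λ x → x ; from-to = λ _ → refl ; to-from = λ _ → refl
                 ; to-pres = λ r → r ; from-pres = λ r → r }

module _ {A B : Set a} {R : Rel A a} {S : Rel B a} where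

  ≃ₒ-sym : R ≃ₒ S → S ≃ₒ R
  ≃ₒ-sym Φ = record { to = from Φ ; from = to Φ ; from-to = to-from Φ ; to-from = from-to Φ
                    ; to-pres = from-pres Φ ; from-pres = to-pres Φ }

  ≃ₒ-trans : {C : Set a} {T : Rel C a} → R ≃ₒ S → S ≃ₒ T → R ≃ₒ T
  ≃ₒ-trans Φ Ψ = record
    { to        = λ x → to Ψ (to Φ x)
    ; from      = λ z → from Φ (from Ψ z)
    ; from-to   = λ x → trans (cong (from Φ) (from-to Ψ (to Φ x))) (from-to Φ x)
    ; to-from   = λ z → trans (cong (to Ψ) (to-from Φ (from Ψ z))) (to-from Ψ z)
    ; to-pres   = λ r → to-pres Ψ (to-pres Φ r)
    ; from-pres = λ r → from-pres Φ (from-pres Ψ r) }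

Below : {A : Set a} → Rel A a → A → Set a
Below {A = A} _<_ x = Σ[ y ∈ A ] (y < x)

_↓_ : {A : Set a} (R : Rel A a) (x : A) → Rel (Below R x) a
(_<_ ↓ x) (y , _) (z , _) = y < z

module _ {A : Set a} {R : Rel A a} (R-prop : ∀ x y → isProp (R x y)) where

  ↓-≃ₒ-↔ : ∀ {x y} → (∀ z → R z x ↔ R z y) → (R ↓ x) ≃ₒ (R ↓ y)
  ↓-≃ₒ-↔ {x} {y} E = record
    { to        = λ (z , z<x) → z , proj₁ (E z) z<x
    ; from      = λ (z , z<y) → z , proj₂ (E z) z<y
    ; from-to   = λ _ → Σ-≡-prop (λ z → R-prop z x) refl
    ; to-from   = λ _ → Σ-≡-prop (λ z → R-prop z y) refl
    ; to-pres   = λ r → r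
    ; from-pres = λ r → r }

  ↓-↓ : (∀ x y z → R x y → R y z → R x z)
      → ∀ x y (y<x : R y x) → ((R ↓ x) ↓ (y , y<x)) ≃ₒ (R ↓ y)
  ↓-↓ R-trans x y y<x = record
    { to        = λ ((z , _) , z<y) → z , z<y
    ; from      = λ (z , z<y) → (z , R-trans z y x z<y y<x) , z<y
    ; from-to   = λ ((z , _) , z<y) → cong (λ z<x → (z , z<x) , z<y) (R-prop z x _ _)
    ; to-from   = λ _ → refl
    ; to-pres   = λ r → r
    ; from-pres = λ r → r }

↓-resp-≃ₒ : {A B : Set a} {R : Rel A a} {S : Rel B a}
          → (∀ x y → isProp (R x y)) → (∀ x y → isProp (S x y))
          → (Φ : R ≃ₒ S) (x : A) → (R ↓ x) ≃ₒ (S ↓ to Φ x)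
↓-resp-≃ₒ {R = R} R-prop S-prop Φ x = record
  { to        = λ (y , y<x) → to Φ y , to-pres Φ y<x
  ; from      = λ (y , y<Φx) → from Φ y , subst (R (from Φ y)) (from-to Φ x) (from-pres Φ y<Φx)
  ; from-to   = λ (y , _) → Σ-≡-prop (λ z → R-prop z x) (from-to Φ y)
  ; to-from   = λ (y , _) → Σ-≡-prop (λ z → S-prop z (to Φ x)) (to-from Φ y)
  ; to-pres   = to-pres Φ
  ; from-pres = from-pres Φ }

module OrdinalProperties {A : Set a} {_<_ : Rel A a} (ordinal : IsOrdinal A _<_) where
  open IsOrdinal ordinal

  ↓-≃ₒ-fixes : ∀ {x y} (Φ : (_<_ ↓ x) ≃ₒ (_<_ ↓ y)) z (z<x : z < x) → proj₁ (to Φ (z , z<x)) ≡ z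
  ↓-≃ₒ-fixes {x} {y} Φ z z<x = go z (well-founded z) z<x
    where
      image : ∀ {z} → z < x → A
      image z<x = proj₁ (to Φ (_ , z<x))

      go : ∀ z → Acc _<_ z → (z<x : z < x) → image z<x ≡ z
      go z (acc rs) z<x = extensional (image z<x) z λ t → below-image⇒below t , below⇒below-image t
        where
          below⇒below-image : ∀ t → t < z → t < image z<x
          below⇒below-image t t<z = subst (_< image z<x) (go t (rs t<z) t<x) (to-pres Φ {t , t<x} {z , z<x} t<z)
            where
              t<x : t < x
              t<x = transitive t z x t<z z<x

          below-image⇒below : ∀ t → t < image z<x → t < z
          below-image⇒below t t<Φz = subst (_< z) t'≡t t'<z
            where
              t<y : t < y
              t<y = transitive t _ y t<Φz (proj₂ (to Φ (z , z<x)))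

              t' : A
              t' = proj₁ (from Φ (t , t<y))

              t'<z : t' < z
              t'<z = subst (λ w → t' < proj₁ w) (from-to Φ (z , z<x))
                           (from-pres Φ {t , t<y} {to Φ (z , z<x)} t<Φz)

              t'≡t : t' ≡ t
              t'≡t = trans (sym (go t' (rs t'<z) (proj₂ (from Φ (t , t<y))))) (cong proj₁ (to-from Φ (t , t<y)))

  ↓-injective : ∀ {x y} → (_<_ ↓ x) ≃ₒ (_<_ ↓ y) → x ≡ y
  ↓-injective {x} {y} Φ = extensional x y λ t →
      (λ t<x → subst (_< y) (↓-≃ₒ-fixes Φ t t<x) (proj₂ (to Φ (t , t<x))))
    , (λ t<y → subst (_< x) (↓-≃ₒ-fixes (≃ₒ-sym Φ) t t<y) (proj₂ (from Φ (t , t<y))))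

  carrier-isSet : FunExt → isSet A
  carrier-isSet fe = hedberg (λ x y → ∀ z → (z < x) ↔ (z < y))
    (λ x y → Π-isProp fe λ z → ↔-isProp fe (prop-valued z x) (prop-valued z y))
    (λ _ _ → (λ r → r) , (λ r → r))
    extensional

  Below-isSet : FunExt → ∀ x → isSet (Below _<_ x)
  Below-isSet fe x = Σ-isSet (carrier-isSet fe) λ y → prop-valued y x

module _ (pt : PropTrunc) {A B : Set a} {R : Rel A a} {S : Rel B a} where
  open OrdinalOrder pt using (_≅_)

  ≃ₒ⇒≅ : isSet B → R ≃ₒ S → R ≅ S
  ≃ₒ⇒≅ B-set Φ = to Φ , to-isEquiv , λ x y → to-pres Φ , to-reflects
    where
      to-isEquiv : isEquiv (to Φ)
      to-isEquiv = injective-surjective⇒isEquiv pt (to Φ) B-set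
        (λ x x' e → trans (sym (from-to Φ x)) (trans (cong (from Φ) e) (from-to Φ x')))
        (λ y → PropTrunc.∣_∣ pt (from Φ y , to-from Φ y))

      to-reflects : ∀ {x y} → S (to Φ x) (to Φ y) → R x y
      to-reflects {x} {y} r = subst₂ R (from-to Φ x) (from-to Φ y) (from-pres Φ r)

  ≅⇒≃ₒ : R ≅ S → R ≃ₒ S
  ≅⇒≃ₒ (f , f-isEquiv , f-order) = record
    { to        = f
    ; from      = f⁻¹
    ; from-to   = λ x → cong proj₁ (proj₂ (f-isEquiv (f x)) (x , refl))
    ; to-from   = f-f⁻¹
    ; to-pres   = λ {x} {y} → proj₁ (f-order x y)
    ; from-pres = λ {x} {y} r →
        proj₂ (f-order (f⁻¹ x) (f⁻¹ y)) (subst₂ S (sym (f-f⁻¹ x)) (sym (f-f⁻¹ y)) r) }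
    where
      f⁻¹ : B → A
      f⁻¹ y = proj₁ (proj₁ (f-isEquiv y))

      f-f⁻¹ : ∀ y → f (f⁻¹ y) ≡ y
      f-f⁻¹ y = proj₂ (proj₁ (f-isEquiv y))

module Supremum (fe : FunExt) (pe : PropExt) (pt : PropTrunc) (sq : SmallSetQuotients)
                {ℓ : Level} {I : Set ℓ} (α : I → Ordinal ℓ) where
  open PropTrunc pt
  open OrdinalOrder pt

  module Component (i : I) where
    open IsOrdinal (isOrdinal (α i)) public
    open OrdinalProperties (isOrdinal (α i)) public

  order : (i : I) → Rel ⟨ α i ⟩ ℓ
  order i = _≺_ (α i)

  Point : Set ℓ
  Point = Σ[ i ∈ I ] ⟨ α i ⟩

  segment : (p : Point) → Rel (Below (order (proj₁ p)) (proj₂ p)) ℓ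
  segment (i , x) = order i ↓ x

  segment-isProp : (p : Point) → ∀ a b → isProp (segment p a b)
  segment-isProp (i , _) (a , _) (b , _) = Component.prop-valued i a b

  _≈_ : Rel Point ℓ
  p ≈ q = ∥ segment p ≃ₒ segment q ∥

  ≈-isPropEquivRel : IsPropEquivRel _≈_
  ≈-isPropEquivRel = record
    { ≈-isProp = λ _ _ → ∥∥-isProp
    ; ≈-refl   = λ _ → ∣ ≃ₒ-refl ∣
    ; ≈-sym    = λ _ _ → ∥∥-map pt ≃ₒ-sym
    ; ≈-trans  = λ _ _ _ → ∥∥-map₂ pt ≃ₒ-trans }

  _⊏_ : Rel Point ℓ
  p ⊏ (j , y) = ∃̇ ⟨ α j ⟩ λ c → order j c y × segment p ≃ₒ segment (j , c)

  ≺⇒⊏ : ∀ {i x y} → order i x y → (i , x) ⊏ (i , y)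
  ≺⇒⊏ {x = x} x<y = ∣ x , x<y , ≃ₒ-refl ∣

  ⊏⇒≺ : ∀ {i x y} → (i , x) ⊏ (i , y) → order i x y
  ⊏⇒≺ {i} {x} {y} = ∥∥-rec (Component.prop-valued i x y)
    λ (c , c<y , Φ) → subst (λ z → order i z y) (sym (Component.↓-injective i Φ)) c<y

  ≃ₒ-segment-below : ∀ {j y k z} → segment (j , y) ≃ₒ segment (k , z) → ∀ {c} → order j c y
                   → Σ[ e ∈ ⟨ α k ⟩ ] (order k e z × segment (j , c) ≃ₒ segment (k , e))
  ≃ₒ-segment-below {j} {y} {k} {z} Φ {c} c<y = e , e<z ,
    ≃ₒ-trans (≃ₒ-sym (↓-↓ (Component.prop-valued j) (Component.transitive j) y c c<y))
    (≃ₒ-trans (↓-resp-≃ₒ (segment-isProp (j , y)) (segment-isProp (k , z)) Φ (c , c<y))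
              (↓-↓ (Component.prop-valued k) (Component.transitive k) z e e<z))
    where
      e : ⟨ α k ⟩
      e = proj₁ (to Φ (c , c<y))

      e<z : order k e z
      e<z = proj₂ (to Φ (c , c<y))

  ⊏-trans : ∀ {p j y k z} → p ⊏ (j , y) → (j , y) ⊏ (k , z) → p ⊏ (k , z)
  ⊏-trans {k = k} = ∥∥-map₂ pt λ (c , c<y , Φ) (d , d<z , Ψ) →
    let (e , e<d , Θ) = ≃ₒ-segment-below Ψ c<y
    in e , Component.transitive k _ _ _ e<d d<z , ≃ₒ-trans Φ Θ

  ⊏-respʳ-≈ : ∀ {p j y k z} → p ⊏ (j , y) → (j , y) ≈ (k , z) → p ⊏ (k , z)
  ⊏-respʳ-≈ = ∥∥-map₂ pt λ (c , c<y , Φ) Ψ →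
    let (e , e<z , Θ) = ≃ₒ-segment-below Ψ c<y
    in e , e<z , ≃ₒ-trans Φ Θ

  ⊏-respˡ-≈ : ∀ {p p' q} → p ≈ p' → p' ⊏ q → p ⊏ q
  ⊏-respˡ-≈ = ∥∥-map₂ pt λ Φ (c , c<y , Ψ) → c , c<y , ≃ₒ-trans Φ Ψ

  open SetQuotient (sq Point _≈_ ≈-isPropEquivRel)

  effective : ∀ {p q} → η p ≡ η q → p ≈ q
  effective = η-effective ≈-isPropEquivRel (sq Point _≈_ ≈-isPropEquivRel) fe pe _ _

  induction : ∀ {c} (P : Q → Set c) → (∀ u → isProp (P u)) → (∀ p → P (η p)) → ∀ u → P u
  induction = η-induction ≈-isPropEquivRel (sq Point _≈_ ≈-isPropEquivRel) pt

  _<_ : Rel Q ℓ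
  u < v = ∥ Σ[ p ∈ Point ] Σ[ q ∈ Point ] (η p ≡ u × η q ≡ v × p ⊏ q) ∥

  η-mono : ∀ {p q} → p ⊏ q → η p < η q
  η-mono {p} {q} p⊏q = ∣ p , q , refl , refl , p⊏q ∣

  η-reflects-< : ∀ {p q} → η p < η q → p ⊏ q
  η-reflects-< = ∥∥-rec ∥∥-isProp λ (p' , q' , ηp'≡ηp , ηq'≡ηq , p'⊏q') →
    ⊏-respˡ-≈ (effective (sym ηp'≡ηp)) (⊏-respʳ-≈ p'⊏q' (effective ηq'≡ηq))

  <-trans : ∀ u v w → u < v → v < w → u < w
  <-trans _ _ _ = ∥∥-map₂ pt λ (p , q , ηp≡u , ηq≡v , p⊏q) (q' , r , ηq'≡v , ηr≡w , q'⊏r) →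
    p , r , ηp≡u , ηr≡w , ⊏-trans p⊏q (⊏-respˡ-≈ (effective (trans ηq≡v (sym ηq'≡v))) q'⊏r)

  <-η-below : ∀ {i x w} → w < η (i , x) → ∃̇ ⟨ α i ⟩ λ c → order i c x × η (i , c) ≡ w
  <-η-below = ∥∥-rec ∥∥-isProp λ (p , q , ηp≡w , ηq≡ηix , p⊏q) →
    ∥∥-map pt (λ (c , c<x , Φ) → c , c<x , trans (η-respects _ p ∣ ≃ₒ-sym Φ ∣) ηp≡w)
              (⊏-respʳ-≈ p⊏q (effective ηq≡ηix))

  ≺⇔<η : ∀ {i b b'} → order i b b' ↔ (η (i , b) < η (i , b'))
  ≺⇔<η = (λ b<b' → η-mono (≺⇒⊏ b<b')) , (λ ηb<ηb' → ⊏⇒≺ (η-reflects-< ηb<ηb'))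

  η-injective-on-component : ∀ {i b b'} → η (i , b) ≡ η (i , b') → b ≡ b'
  η-injective-on-component {i} {b} {b'} ηb≡ηb' =
    ∥∥-rec (Component.carrier-isSet i fe b b') (Component.↓-injective i) (effective ηb≡ηb')

  Below-<-isSet : ∀ u → isSet (Below _<_ u)
  Below-<-isSet u = Σ-isSet Q-isSet λ _ → ∥∥-isProp

  segment-≃ₒ-↓η : (p : Point) → segment p ≃ₒ (_<_ ↓ η p)
  segment-≃ₒ-↓η (i , x) = ≅⇒≃ₒ pt (ι , ι-isEquiv , λ _ _ → ≺⇔<η)
    where
      ι : Below (order i) x → Below _<_ (η (i , x))
      ι (b , b<x) = η (i , b) , proj₁ ≺⇔<η b<x

      ι-isEquiv : isEquiv ι
      ι-isEquiv = injective-surjective⇒isEquiv pt ι (Below-<-isSet (η (i , x)))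
        (λ _ _ ιb≡ιb' → Σ-≡-prop (λ z → Component.prop-valued i z x)
                                 (η-injective-on-component (cong proj₁ ιb≡ιb')))
        (λ (w , w<ηx) → ∥∥-map pt (λ (c , c<x , ηc≡w) → (c , c<x) , Σ-≡-prop (λ _ → ∥∥-isProp) ηc≡w)
                                  (<-η-below w<ηx))

  η-accessible : ∀ {i x} → Acc (order i) x → Acc _<_ (η (i , x))
  η-accessible (acc rs) = acc λ w<ηx →
    ∥∥-rec (Acc-isProp fe) (λ (c , c<x , ηc≡w) → subst (Acc _<_) ηc≡w (η-accessible (rs c<x)))
           (<-η-below w<ηx)

  <-wellFounded : ∀ u → Acc _<_ u
  <-wellFounded = induction _ (λ _ → Acc-isProp fe) λ (i , x) → η-accessible (Component.well-founded i x)

  <-extensional : ∀ u v → (∀ w → (w < u) ↔ (w < v)) → u ≡ v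
  <-extensional = induction _ (λ u → Π-isProp fe λ v → Π-isProp fe λ _ → Q-isSet u v) λ p →
                  induction _ (λ v → Π-isProp fe λ _ → Q-isSet (η p) v) λ q E →
    η-respects p q ∣ ≃ₒ-trans (segment-≃ₒ-↓η p)
                     (≃ₒ-trans (↓-≃ₒ-↔ (λ _ _ → ∥∥-isProp) E) (≃ₒ-sym (segment-≃ₒ-↓η q))) ∣

  sup : Ordinal ℓ
  sup = record
    { ⟨_⟩       = Q
    ; _≺_       = _<_
    ; isOrdinal = record
      { prop-valued  = λ _ _ → ∥∥-isProp
      ; transitive   = <-trans
      ; extensional  = <-extensional
      ; well-founded = <-wellFounded } }

  sup-upper : (i : I) → α i ⪯ sup
  sup-upper i γ = ∥∥-map pt λ (x , γ≅α↓x) →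
    η (i , x) , ≃ₒ⇒≅ pt (Below-<-isSet (η (i , x)))
                        (≃ₒ-trans (≅⇒≃ₒ pt γ≅α↓x) (segment-≃ₒ-↓η (i , x)))

  sup-least : (t : Ordinal ℓ) → ((i : I) → α i ⪯ t) → sup ⪯ t
  sup-least t bounds γ = ∥∥-rec ∥∥-isProp λ (u , γ≅sup↓u) →
    induction (λ u → _≺_ γ ≅ (_<_ ↓ u) → γ ≺ₒ t) (λ _ → Π-isProp fe λ _ → ∥∥-isProp)
      (λ (i , x) γ≅sup↓ηx → bounds i γ ∣ x , ≃ₒ⇒≅ pt (Component.Below-isSet i fe x)
                                          (≃ₒ-trans (≅⇒≃ₒ pt γ≅sup↓ηx) (≃ₒ-sym (segment-≃ₒ-↓η (i , x)))) ∣)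
      u γ≅sup↓u

mainTheorem8 : (fe : FunExt) (pe : PropExt) (pt : PropTrunc) (sq : SmallSetQuotients)
    → (ℓ : Level) → Univalence ℓ
    → (I : Set ℓ) (α : I → Ordinal ℓ) → OrdinalOrder.HasLUB pt α
mainTheorem8 fe pe pt sq ℓ _ I α = sup , sup-upper , sup-least
  where open Supremum fe pe pt sq α
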